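{- Fix a nested system of fundamental sequences on an ordinal $\Gamma$ and let $\alpha\le\Gamma$. If $s=\langle s_0,\dots,s_{m-1}\rangle$ is a nonempty finite subset of $\mathbb{N}$ such that $s^*$ is $\alpha$-large, then there is no strictly decreasing function $h:s\to\alpha$ satisfying $|h(s_i)|\le s_i$ for all $i<m$.
   Context: A fundamental sequence for $\alpha>0$ is a non-decreasing sequence $(\alpha[n])_{n\in\omega}$ with $\sup_n(\alpha[n]+1)=\alpha$; $0[n]=0$. A system on $\Gamma$ fixes one for each $\alpha\le\Gamma$; it is nested if there are never $\gamma<\beta\le\Gamma$ and $n>1$ with $\gamma>\beta[n]>\gamma[n]$. Finite subsets of $\mathbb{N}$ are identified with strictly increasing sequences; $s^*=s\setminus\{\max s\}$; for $t=\langle t_0,\dots,t_{j-1}\rangle$, $\alpha[t]=\alpha[t_0]\cdots[t_{j-1}]$, and $t$ is $\alpha$-large if $\alpha[t]=0$. $\alpha\Rightarrow_n\beta$ means $\beta=\alpha[n]\cdots[n]$ for some finite number (possibly $0$) of applications of $[n]$; the norm $|\beta|$ of $\beta\le\Gamma$ is $\min\{n>1:\Gamma\Rightarrow_n\beta\}$ (this exists for nested systems). -}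

module Defs where

open import Data.Nat using (ℕ; zero; suc) renaming (_<_ to _<ℕ_; _≤_ to _≤ℕ_)
open import Data.Fin using (Fin; inject₁) renaming (_<_ to _<ᶠ_)
open import Data.List using (List; []; _∷_; tabulate)
open import Data.Product using (Σ; _×_; _,_; ∃; ∃-syntax)
open import Data.Sum using (_⊎_)
open import Relation.Binary.PropositionalEquality using (_≡_)
open import Relation.Binary using (Rel; IsStrictTotalOrder)
open import Induction.WellFounded using (WellFounded)
open import Relation.Nullary using (¬_)

-- The ordinals ≤ Γ, presented as a well-order with a greatest element Γ
-- (and least element 0).  Every such well-order is order-isomorphic to
-- the ordinal interval [0, Γ].
record OrdinalInterval : Set₁ where
  field
    Ord    : Set
    _<_    : Rel Ord _
    isSTO  : IsStrictTotalOrder _≡_ _<_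
    wf     : WellFounded _<_
    𝟎      : Ord
    𝟎-min  : ∀ x → x ≡ 𝟎 ⊎ 𝟎 < x
    Γ      : Ord
    Γ-max  : ∀ x → x ≡ Γ ⊎ x < Γ

  _≤_ : Rel Ord _
  x ≤ y = x < y ⊎ x ≡ y

module _ (O : OrdinalInterval) where
  open OrdinalInterval O

  record IsFundamentalSystem (_[_] : Ord → ℕ → Ord) : Set where
    field
      mono    : ∀ α m n → m ≤ℕ n → (α [ m ]) ≤ (α [ n ])
      zero-fs : ∀ n → 𝟎 [ n ] ≡ 𝟎
      -- for α > 0 : sup_n (α[n] + 1) = α, i.e. every α[n]+1 ≤ α and
      -- every β < α lies below some α[n]+1
      below   : ∀ α → 𝟎 < α → ∀ n → (α [ n ]) < α
      cofinal : ∀ α → 𝟎 < α → ∀ β → β < α → ∃[ n ] (β ≤ (α [ n ]))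

  Nested : (Ord → ℕ → Ord) → Set
  Nested _[_] = ∀ γ β n → γ < β → 1 <ℕ n → (β [ n ]) < γ → ¬ ((γ [ n ]) < (β [ n ]))

  iter : (Ord → ℕ → Ord) → Ord → ℕ → ℕ → Ord
  iter _[_] α n zero    = α
  iter _[_] α n (suc k) = iter _[_] α n k [ n ]

  StepsTo : (Ord → ℕ → Ord) → Ord → ℕ → Ord → Set
  StepsTo _[_] α n β = ∃[ k ] (iter _[_] α n k ≡ β)

  -- |β| ≤ k, where |β| = min { n > 1 : Γ ⇒ₙ β }
  NormLE : (Ord → ℕ → Ord) → Ord → ℕ → Set
  NormLE _[_] β k = ∃[ n ] (1 <ℕ n × n ≤ℕ k × StepsTo _[_] Γ n β)

  applySeq : (Ord → ℕ → Ord) → Ord → List ℕ → Ord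
  applySeq _[_] α []      = α
  applySeq _[_] α (t ∷ ts) = applySeq _[_] (α [ t ]) ts

  Large : (Ord → ℕ → Ord) → Ord → List ℕ → Set
  Large _[_] α t = applySeq _[_] α t ≡ 𝟎

-- s* = s without its last (maximal) element, for s = ⟨s₀,…,s_m⟩ given
-- as a function Fin (suc m) → ℕ
init* : ∀ {m} → (Fin (suc m) → ℕ) → List ℕ
init* {m} s = tabulate {n = m} (λ i → s (inject₁ i))

StrictlyIncreasing : ∀ {m} → (Fin m → ℕ) → Set
StrictlyIncreasing s = ∀ i j → i <ᶠ j → s i <ℕ s j

{-# OPTIONS --safe #-}
-- A nested system has the Bachmann property: if Γ ⇒ₖ γ with k > 1 and
-- γ < α, then γ ≤ α[k].  Combined with monotonicity of α[·] this gives
-- β ≤ α[n] whenever β < α and |β| ≤ n.  So along a descent h, each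
-- h(sᵢ₊₁) < h(sᵢ) ≤ α[s₀]⋯[sᵢ], and the last value would lie below
-- α[s*] = 0.
module Submission where

open import Defs
open import Data.Nat using (ℕ; suc; zero) renaming (_<_ to _<ℕ_)
open import Data.Fin using (Fin; inject₁; fromℕ) renaming (_<_ to _<ᶠ_; zero to fzero; suc to fsuc)
open import Data.Fin.Properties using (≤̄⇒inject₁<) renaming (≤-refl to ≤ᶠ-refl)
open import Data.Product using (Σ; _×_; _,_)
open import Data.Sum using (inj₁; inj₂)
open import Relation.Nullary using (¬_; contradiction)
open import Relation.Binary using (IsStrictTotalOrder; IsPartialOrder; tri<; tri≈; tri>)
open import Relation.Binary.PropositionalEquality using (_≡_; refl; subst)
import Relation.Binary.Construct.StrictToNonStrict as StrictToNonStrict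

module OrderProperties (O : OrdinalInterval) where
  open OrdinalInterval O
  open IsStrictTotalOrder isSTO using (compare; irrefl; asym; isStrictPartialOrder; <-respʳ-≈)
    renaming (trans to <-trans)
  private module NonStrict = StrictToNonStrict _≡_ _<_

  ≤-trans : ∀ {x y z} → x ≤ y → y ≤ z → x ≤ z
  ≤-trans = IsPartialOrder.trans (NonStrict.isPartialOrder isStrictPartialOrder)

  <-≤-trans : ∀ {x y z} → x < y → y ≤ z → x < z
  <-≤-trans = NonStrict.<-≤-trans <-trans <-respʳ-≈

  ≮⇒≥ : ∀ {x y} → ¬ (y < x) → x ≤ y
  ≮⇒≥ {x} {y} y≮x with compare x y
  ... | tri< x<y _ _ = inj₁ x<y
  ... | tri≈ _ x≡y _ = inj₂ x≡y
  ... | tri> _ _ y<x = contradiction y<x y≮x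

  ≮𝟎 : ∀ {x} → ¬ (x < 𝟎)
  ≮𝟎 {x} x<𝟎 with 𝟎-min x
  ... | inj₁ refl = irrefl refl x<𝟎
  ... | inj₂ 𝟎<x = asym 𝟎<x x<𝟎

  Γ≮ : ∀ {x} → ¬ (Γ < x)
  Γ≮ {x} Γ<x with Γ-max x
  ... | inj₁ refl = irrefl refl Γ<x
  ... | inj₂ x<Γ = asym x<Γ Γ<x

module _ {O : OrdinalInterval} {_[_] : OrdinalInterval.Ord O → ℕ → OrdinalInterval.Ord O}
         (fs : IsFundamentalSystem O _[_]) (nested : Nested O _[_]) where
  open OrdinalInterval O
  open IsFundamentalSystem fs
  open OrderProperties O
  open IsStrictTotalOrder isSTO using (compare)

  []-≤ : ∀ γ k → (γ [ k ]) ≤ γ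
  []-≤ γ k with 𝟎-min γ
  ... | inj₁ refl = inj₂ (zero-fs k)
  ... | inj₂ 𝟎<γ = inj₁ (below γ 𝟎<γ k)

  iter-Γ-<⇒≤[] : ∀ {k α} j → 1 <ℕ k → iter O _[_] Γ k j < α → iter O _[_] Γ k j ≤ (α [ k ])
  iter-Γ-<⇒≤[] zero 1<k Γ<α = contradiction Γ<α Γ≮
  iter-Γ-<⇒≤[] {k} {α} (suc j) 1<k γ[k]<α with compare α (iter O _[_] Γ k j)
  -- γ[k] < α < γ: nestedness forbids α[k] < γ[k].
  ... | tri< α<γ _ _ = ≮⇒≥ (nested α (iter O _[_] Γ k j) k α<γ 1<k γ[k]<α)
  ... | tri≈ _ refl _ = inj₂ refl
  ... | tri> _ _ γ<α = ≤-trans ([]-≤ (iter O _[_] Γ k j) k) (iter-Γ-<⇒≤[] j 1<k γ<α)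

  StepsTo-Γ-<⇒≤[] : ∀ {k γ α} → 1 <ℕ k → StepsTo O _[_] Γ k γ → γ < α → γ ≤ (α [ k ])
  StepsTo-Γ-<⇒≤[] 1<k (j , refl) = iter-Γ-<⇒≤[] j 1<k

  NormLE-<⇒≤[] : ∀ {β α n} → NormLE O _[_] β n → β < α → β ≤ (α [ n ])
  NormLE-<⇒≤[] {α = α} (k , 1<k , k≤n , Γ⇒β) β<α =
    ≤-trans (StepsTo-Γ-<⇒≤[] 1<k Γ⇒β β<α) (mono α k _ k≤n)

  descent-<-applySeq : ∀ {m α} (s : Fin (suc m) → ℕ) (h : Fin (suc m) → Ord)
    → h fzero < α
    → (∀ (i : Fin m) → h (fsuc i) < h (inject₁ i))
    → (∀ i → NormLE O _[_] (h i) (s i))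
    → h (fromℕ m) < applySeq O _[_] α (init* s)
  descent-<-applySeq {zero} s h h₀<α _ _ = h₀<α
  descent-<-applySeq {suc m} s h h₀<α descent norm =
    descent-<-applySeq (λ i → s (fsuc i)) (λ i → h (fsuc i))
      (<-≤-trans (descent fzero) (NormLE-<⇒≤[] (norm fzero) h₀<α))
      (λ i → descent (fsuc i))
      (λ i → norm (fsuc i))

lemma2p14 : (O : OrdinalInterval) → (_[_] : OrdinalInterval.Ord O → ℕ → OrdinalInterval.Ord O)
    → IsFundamentalSystem O _[_] → Nested O _[_]
    → (α : OrdinalInterval.Ord O)
    → (m : ℕ) (s : Fin (suc m) → ℕ) → StrictlyIncreasing s
    → Large O _[_] α (init* s)
    → ¬ (Σ (Fin (suc m) → OrdinalInterval.Ord O) λ h →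
           ((i : Fin (suc m)) → OrdinalInterval._<_ O (h i) α)
         × ((i j : Fin (suc m)) → i <ᶠ j → OrdinalInterval._<_ O (h j) (h i))
         × ((i : Fin (suc m)) → NormLE O _[_] (h i) (s i)))
lemma2p14 O _[_] fs nested α m s _ large (h , h<α , decreasing , norm) =
  OrderProperties.≮𝟎 O (subst (h (fromℕ m) <_) large h[last]<α[s*])
  where
  open OrdinalInterval O using (_<_)
  consecutive : ∀ (i : Fin m) → h (fsuc i) < h (inject₁ i)
  consecutive i = decreasing (inject₁ i) (fsuc i) (≤̄⇒inject₁< ≤ᶠ-refl)
  h[last]<α[s*] : h (fromℕ m) < applySeq O _[_] α (init* s)
  h[last]<α[s*] = descent-<-applySeq fs nested s h (h<α fzero) consecutive norm
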